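{- There exist a $\mathsf{JRC}$-formula $\phi$ and an atomic proposition $p$ such that (1) $\not\vDash_{\mathsf{JRC}}(p\wedge{\sim}p)\rightsquigarrow\phi$ and (2) $\not\vDash_{\mathsf{JRC}}\phi\rightsquigarrow(p\vee{\sim}p)$.
   Context: Language of $\mathsf{JRC}$: countable sets $\mathsf{Var}$ and $\mathsf{Prop}$; terms $t ::= x \mid t+t$ ($x\in\mathsf{Var}$); formulas $\phi ::= p \mid {\sim}\phi \mid \phi\wedge\phi \mid \phi\rightarrow\phi \mid \phi\rightsquigarrow\phi \mid t{:}\phi$; $\phi\vee\psi$ abbreviates ${\sim}({\sim}\phi\wedge{\sim}\psi)$. A Routley relational model is $\mathcal M=(W,W_N,R,R_{Fm},R_{Tm},{*},\mathcal V)$ where $W$ is a nonempty set, $\emptyset\ne W_N\subseteq W$ (normal states); $R\subseteq W\times W\times W$ satisfies: for $w\in W_N$, $Rwvu$ iff $v=u$; $R_{Fm}$ assigns to each formula $\phi$ a relation $R_\phi\subseteq W\times W$; $R_{Tm}$ assigns to each term $t$ a relation $R_t\subseteq W\times W$; ${*}:W\to W$ with $w^{**}=w$; $\mathcal V:\mathsf{Prop}\to\mathcal P(W)$. $R_\phi(w)=\{v:wR_\phi v\}$, $[\![\phi]\!]=\{w\in W:(\mathcal M,w)\vDash\phi\}$. Truth at every $w\in W$: $p$ iff $w\in\mathcal V(p)$; ${\sim}\phi$ iff $(\mathcal M,w^*)\nvDash\phi$; $\phi\wedge\psi$ iff both; $\phi\rightarrow\psi$ iff for all $v,u$ with $Rwvu$,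 $v\vDash\phi$ implies $u\vDash\psi$; $\phi\rightsquigarrow\psi$ iff for all $v$ with $wR_\phi v$, $v\vDash\psi$; $t{:}\phi$ iff for all $v$ with $wR_tv$, $v\vDash\phi$. A $\mathsf{JRC}$-model is one satisfying: (1) for $w\in W_N$, $R_\phi(w)\subseteq[\![\phi]\!]$; (2) for all $w\in W$, $w\in[\![\phi]\!]$ implies $w\in R_\phi(w)$; (3) $R_{s+t}\subseteq R_s\cap R_t$ for all terms $s,t$. $\vDash_{\mathsf{JRC}}\phi$ means $\phi$ is true at every normal state of every $\mathsf{JRC}$-model. -}

module Defs where

open import Data.Nat using (ℕ)
open import Data.Product using (_×_)
open import Relation.Binary.PropositionalEquality using (_≡_)
open import Relation.Nullary using (¬_)
open import Level using (suc; zero)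

Var : Set
Var = ℕ

Prop : Set
Prop = ℕ

data Tm : Set where
  var : Var → Tm
  _⊕_ : Tm → Tm → Tm

infixr 6 _∧_
infixr 5 _⇒_ _↝_
infix 7 _∶_

data Fm : Set where
  atom : Prop → Fm
  ∼_   : Fm → Fm
  _∧_  : Fm → Fm → Fm
  _⇒_  : Fm → Fm → Fm
  _↝_  : Fm → Fm → Fm
  _∶_  : Tm → Fm → Fm

_∨_ : Fm → Fm → Fm
φ ∨ ψ = ∼ ((∼ φ) ∧ (∼ ψ))

record Model : Set₁ where
  field
    W      : Set
    WN     : W → Set
    WN-ne  : W
    WN-ne∈ : WN WN-ne
    R      : W → W → W → Set
    R-norm : ∀ w v u → WN w → (R w v u → v ≡ u) × (v ≡ u → R w v u)
    RFm    : Fm → W → W → Set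
    RTm    : Tm → W → W → Set
    star   : W → W
    star-inv : ∀ w → star (star w) ≡ w
    V      : Prop → W → Set

open Model public

_,_⊨_ : (M : Model) → W M → Fm → Set
M , w ⊨ atom p  = V M p w
M , w ⊨ (∼ φ)   = ¬ (M , star M w ⊨ φ)
M , w ⊨ (φ ∧ ψ) = (M , w ⊨ φ) × (M , w ⊨ ψ)
M , w ⊨ (φ ⇒ ψ) = ∀ v u → R M w v u → M , v ⊨ φ → M , u ⊨ ψ
M , w ⊨ (φ ↝ ψ) = ∀ v → RFm M φ w v → M , v ⊨ ψ
M , w ⊨ (t ∶ φ) = ∀ v → RTm M t w v → M , v ⊨ φ

record IsJRC (M : Model) : Set where
  field
    c1 : ∀ φ w v → WN M w → RFm M φ w v → M , v ⊨ φ
    c2 : ∀ φ w → M , w ⊨ φ → RFm M φ w w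
    c3 : ∀ s t w v → RTm M (s ⊕ t) w v → RTm M s w v × RTm M t w v

⊨JRC : Fm → Set₁
⊨JRC φ = (M : Model) → IsJRC M → (w : W M) → WN M w → M , w ⊨ φ

-- In the Routley-star semantics a state w with w* ≠ w can be a glut (p ∧ ∼p
-- holds at w when p holds at w but fails at w*) or a gap (p ∨ ∼p fails at w*).
-- Interpreting R_φ from every state by [[φ]] itself satisfies the JRC
-- conditions, and then φ ↝ ψ holds at a normal state exactly when
-- [[φ]] ⊆ [[ψ]].  Two states a* = b with p true only at a and q true only at b
-- refute both implications with φ = q: a is a glut where q fails, b a gap
-- where q holds.
module Submission where

open import Defs
open import Data.Product using (Σ; _×_; _,_)
open import Data.Empty using (⊥)
open import Data.Unit using (⊤; tt)
open import Relation.Nullary using (¬_)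
open import Relation.Binary.PropositionalEquality using (_≡_; refl)
open import Function using (id)

module FullModel
  (S : Set) (N : S → Set) (n : S) (n∈N : N n)
  (star′ : S → S) (star′-inv : ∀ w → star′ (star′ w) ≡ w)
  (V′ : Prop → S → Set)
  where

  -- The extension of φ, with t ∶ φ vacuously true; this breaks the circularity
  -- of letting R_φ depend on truth in the model being defined.
  ⟦_⟧ : Fm → S → Set
  ⟦ atom p ⟧ w = V′ p w
  ⟦ ∼ φ ⟧ w = ¬ ⟦ φ ⟧ (star′ w)
  ⟦ φ ∧ ψ ⟧ w = ⟦ φ ⟧ w × ⟦ ψ ⟧ w
  ⟦ φ ⇒ ψ ⟧ w = ∀ v u → v ≡ u → ⟦ φ ⟧ v → ⟦ ψ ⟧ u
  ⟦ φ ↝ ψ ⟧ w = ∀ v → ⟦ φ ⟧ v → ⟦ ψ ⟧ v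
  ⟦ t ∶ φ ⟧ w = ⊤

  model : Model
  model = record
    { W = S ; WN = N ; WN-ne = n ; WN-ne∈ = n∈N
    ; R = λ w v u → v ≡ u
    ; R-norm = λ w v u _ → id , id
    ; RFm = λ φ w v → ⟦ φ ⟧ v
    ; RTm = λ t w v → ⊥
    ; star = star′ ; star-inv = star′-inv ; V = V′ }

  ⊨⇒∈⟦⟧ : ∀ φ w → model , w ⊨ φ → ⟦ φ ⟧ w
  ∈⟦⟧⇒⊨ : ∀ φ w → ⟦ φ ⟧ w → model , w ⊨ φ
  ⊨⇒∈⟦⟧ (atom p) w h = h
  ⊨⇒∈⟦⟧ (∼ φ) w h x = h (∈⟦⟧⇒⊨ φ (star′ w) x)
  ⊨⇒∈⟦⟧ (φ ∧ ψ) w (h , k) = ⊨⇒∈⟦⟧ φ w h , ⊨⇒∈⟦⟧ ψ w k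
  ⊨⇒∈⟦⟧ (φ ⇒ ψ) w h v u v≡u x = ⊨⇒∈⟦⟧ ψ u (h v u v≡u (∈⟦⟧⇒⊨ φ v x))
  ⊨⇒∈⟦⟧ (φ ↝ ψ) w h v x = ⊨⇒∈⟦⟧ ψ v (h v x)
  ⊨⇒∈⟦⟧ (t ∶ φ) w h = tt
  ∈⟦⟧⇒⊨ (atom p) w x = x
  ∈⟦⟧⇒⊨ (∼ φ) w x h = x (⊨⇒∈⟦⟧ φ (star′ w) h)
  ∈⟦⟧⇒⊨ (φ ∧ ψ) w (x , y) = ∈⟦⟧⇒⊨ φ w x , ∈⟦⟧⇒⊨ ψ w y
  ∈⟦⟧⇒⊨ (φ ⇒ ψ) w x v u v≡u h = ∈⟦⟧⇒⊨ ψ u (x v u v≡u (⊨⇒∈⟦⟧ φ v h))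
  ∈⟦⟧⇒⊨ (φ ↝ ψ) w x v y = ∈⟦⟧⇒⊨ ψ v (x v y)
  ∈⟦⟧⇒⊨ (t ∶ φ) w x v ()

  isJRC : IsJRC model
  isJRC = record
    { c1 = λ φ w v _ → ∈⟦⟧⇒⊨ φ v
    ; c2 = λ φ w → ⊨⇒∈⟦⟧ φ w
    ; c3 = λ s t w v () }

  ⊭JRC-↝ : ∀ φ ψ v → ⟦ φ ⟧ v → ¬ ⟦ ψ ⟧ v → ¬ ⊨JRC (φ ↝ ψ)
  ⊭JRC-↝ φ ψ v φ∈v ψ∉v ⊨φ↝ψ =
    ψ∉v (⊨⇒∈⟦⟧ ψ v (⊨φ↝ψ model isJRC n n∈N v φ∈v))

data State : Set where
  n a b : State

star-swap : State → State
star-swap n = n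
star-swap a = b
star-swap b = a

star-swap-inv : ∀ w → star-swap (star-swap w) ≡ w
star-swap-inv n = refl
star-swap-inv a = refl
star-swap-inv b = refl

p q : Prop
p = 0
q = 1

val : Prop → State → Set
val 0 a = ⊤
val 0 _ = ⊥
val _ a = ⊥
val _ _ = ⊤

open FullModel State (_≡ n) n refl star-swap star-swap-inv val

glut-a : ⟦ atom p ∧ ∼ atom p ⟧ a
glut-a = tt , λ ()

gap-b : ¬ ⟦ atom p ∨ (∼ atom p) ⟧ b
gap-b excluded-middle = excluded-middle ((λ ()) , λ ¬p-at-a → ¬p-at-a tt)

lemma13 : Σ Fm (λ φ → Σ Prop (λ p →
    (¬ ⊨JRC ((atom p ∧ (∼ atom p)) ↝ φ))
    × (¬ ⊨JRC (φ ↝ (atom p ∨ (∼ atom p))))))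
lemma13 = atom q , p
        , ⊭JRC-↝ (atom p ∧ ∼ atom p) (atom q) a glut-a (λ ())
        , ⊭JRC-↝ (atom q) (atom p ∨ (∼ atom p)) b tt gap-b
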